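{- Assume $(\Gamma,\Omega,\Delta)=(\Gamma',\Omega',\Delta')$ (as sets of declarations). If $\Gamma;\Omega;\Delta\vdash M:A$ and $\Gamma';\Omega';\Delta'\vdash M:A'$, then $A=A'$.
   Context: Strict $\lambda$-calculus over a fixed signature $\Sigma$ declaring atomic types and constants $c{:}A$, each at most once. Labels $k\in\{1,0,u\}$; types $A::=a\mid A_1\to^kA_2$; terms $c\mid x\mid\lambda x^k{:}A.M\mid M_1M_2^k$. Contexts: finite sets of declarations $x{:}A$ with distinct variables; $(\Gamma_1,\Gamma_2)$ denotes union with disjoint domains. Typing $\Gamma;\Omega;\Delta\vdash M:A$ ($\Gamma$ unrestricted, $\Omega$ irrelevant, $\Delta$ strict; pairwise disjoint domains): if $c{:}A\in\Sigma$ then $\Gamma;\Omega;\cdot\vdash c:A$; $(\Gamma,x{:}A);\Omega;\cdot\vdash x:A$; $\Gamma;\Omega;x{:}A\vdash x:A$ (no rule for variables of $\Omega$); from $(\Gamma,x{:}A);\Omega;\Delta\vdash M:B$ infer $\Gamma;\Omega;\Delta\vdash\lambda x^u{:}A.M:A\to^uB$; from $\Gamma;(\Omega,x{:}A);\Delta\vdash M:B$ infer $\Gamma;\Omega;\Delta\vdash\lambda x^0{:}A.M:A\to^0B$; from $\Gamma;\Omega;(\Delta,x{:}A)\vdash M:B$ infer $\Gamma;\Omega;\Delta\vdash\lambda x^1{:}A.M:A\to^1B$; from $\Gamma;\Omega;\Delta\vdash M:A\to^uB$ and $(\Gamma,\Delta);\Omega;\cdot\vdash N:A$ infer $\Gamma;\Omega;\Delta\vdash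 MN^u:B$; from $\Gamma;\Omega;\Delta\vdash M:A\to^0B$ and $(\Gamma,\Omega,\Delta);\cdot;\cdot\vdash N:A$ infer $\Gamma;\Omega;\Delta\vdash MN^0:B$; from $(\Gamma,\Delta_N);\Omega;\Delta_M\vdash M:A\to^1B$ and $(\Gamma,\Delta_M);\Omega;\Delta_N\vdash N:A$ infer $\Gamma;\Omega;(\Delta_M,\Delta_N)\vdash MN^1:B$. -}

module Defs where

open import Data.Nat using (ℕ)
open import Data.Product using (_×_; _,_; proj₁)
open import Data.List using (List; []; _∷_; _++_; map)
open import Data.List.Membership.Propositional using (_∈_; _∉_)
open import Data.List.Relation.Unary.Unique.Propositional using (Unique)
open import Data.List.Relation.Binary.Permutation.Propositional using (_↭_)

AtomName : Set
AtomName = ℕ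

ConstName : Set
ConstName = ℕ

Var : Set
Var = ℕ

data Label : Set where
  one zero u : Label

data Ty : Set where
  atom : AtomName → Ty
  _⇒[_]_ : Ty → Label → Ty → Ty

data Tm : Set where
  con : ConstName → Tm
  var : Var → Tm
  lam : Var → Label → Ty → Tm → Tm
  app : Tm → Tm → Label → Tm

record Signature : Set where
  field
    atoms  : List AtomName
    consts : List (ConstName × Ty)
open Signature public

ConstsUnique : Signature → Set
ConstsUnique Σ = Unique (map proj₁ (consts Σ))

-- Contexts: lists of declarations x : A; they are read as sets, and
-- (Γ₁ , Γ₂) is rendered as Γ₁ ++ Γ₂.
Ctx : Set
Ctx = List (Var × Ty)

dom : Ctx → List Var
dom Γ = map proj₁ Γ

WF : Ctx → Ctx → Ctx → Set
WF Γ Ω Δ = Unique (dom (Γ ++ Ω ++ Δ))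

data _∣_⨾_⨾_⊢_∶_ (Σ : Signature) : Ctx → Ctx → Ctx → Tm → Ty → Set where
  ⊢con  : ∀ {Γ Ω c A} → WF Γ Ω [] → (c , A) ∈ consts Σ →
          Σ ∣ Γ ⨾ Ω ⨾ [] ⊢ con c ∶ A
  ⊢varu : ∀ {Γ Ω x A} → WF Γ Ω [] → (x , A) ∈ Γ →
          Σ ∣ Γ ⨾ Ω ⨾ [] ⊢ var x ∶ A
  ⊢var1 : ∀ {Γ Ω x A} → WF Γ Ω ((x , A) ∷ []) →
          Σ ∣ Γ ⨾ Ω ⨾ ((x , A) ∷ []) ⊢ var x ∶ A
  ⊢lamu : ∀ {Γ Ω Δ x A M B} → x ∉ dom (Γ ++ Ω ++ Δ) →
          Σ ∣ ((x , A) ∷ Γ) ⨾ Ω ⨾ Δ ⊢ M ∶ B →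
          Σ ∣ Γ ⨾ Ω ⨾ Δ ⊢ lam x u A M ∶ (A ⇒[ u ] B)
  ⊢lam0 : ∀ {Γ Ω Δ x A M B} → x ∉ dom (Γ ++ Ω ++ Δ) →
          Σ ∣ Γ ⨾ ((x , A) ∷ Ω) ⨾ Δ ⊢ M ∶ B →
          Σ ∣ Γ ⨾ Ω ⨾ Δ ⊢ lam x zero A M ∶ (A ⇒[ zero ] B)
  ⊢lam1 : ∀ {Γ Ω Δ x A M B} → x ∉ dom (Γ ++ Ω ++ Δ) →
          Σ ∣ Γ ⨾ Ω ⨾ ((x , A) ∷ Δ) ⊢ M ∶ B →
          Σ ∣ Γ ⨾ Ω ⨾ Δ ⊢ lam x one A M ∶ (A ⇒[ one ] B)
  ⊢appu : ∀ {Γ Ω Δ M N A B} →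
          Σ ∣ Γ ⨾ Ω ⨾ Δ ⊢ M ∶ (A ⇒[ u ] B) →
          Σ ∣ (Γ ++ Δ) ⨾ Ω ⨾ [] ⊢ N ∶ A →
          Σ ∣ Γ ⨾ Ω ⨾ Δ ⊢ app M N u ∶ B
  ⊢app0 : ∀ {Γ Ω Δ M N A B} →
          Σ ∣ Γ ⨾ Ω ⨾ Δ ⊢ M ∶ (A ⇒[ zero ] B) →
          Σ ∣ (Γ ++ Ω ++ Δ) ⨾ [] ⨾ [] ⊢ N ∶ A →
          Σ ∣ Γ ⨾ Ω ⨾ Δ ⊢ app M N zero ∶ B
  ⊢app1 : ∀ {Γ Ω Δ ΔM ΔN M N A B} → Δ ↭ (ΔM ++ ΔN) →
          Σ ∣ (Γ ++ ΔN) ⨾ Ω ⨾ ΔM ⊢ M ∶ (A ⇒[ one ] B) →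
          Σ ∣ (Γ ++ ΔM) ⨾ Ω ⨾ ΔN ⊢ N ∶ A →
          Σ ∣ Γ ⨾ Ω ⨾ Δ ⊢ app M N one ∶ B

_≈ˢ_ : Ctx → Ctx → Set
Φ ≈ˢ Ψ = ∀ d → (d ∈ Φ → d ∈ Ψ) × (d ∈ Ψ → d ∈ Φ)

{-# OPTIONS --safe #-}
module Submission where

open import Defs
open import Data.Empty using (⊥-elim)
open import Data.List using (List; _∷_; _++_; map)
open import Data.List.Membership.Propositional using (_∈_)
open import Data.List.Membership.Propositional.Properties using (∈-map⁺; ∈-++⁺ˡ; ∈-++⁺ʳ)
open import Data.List.Relation.Unary.Any using (here; there)
open import Data.List.Relation.Unary.AllPairs using (_∷_)
open import Data.List.Relation.Unary.Unique.Propositional using (Unique)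
open import Data.List.Relation.Unary.Unique.Propositional.Properties using (Unique[x∷xs]⇒x∉xs)
open import Data.List.Relation.Binary.Subset.Propositional using (_⊆_)
open import Data.List.Relation.Binary.Subset.Propositional.Properties
  using (∷⁺ʳ; ⊆-respˡ-↭; ⊆-respʳ-↭)
open import Data.List.Relation.Binary.Permutation.Propositional
  using (_↭_; ↭-sym; ↭-trans; module PermutationReasoning)
open import Data.List.Relation.Binary.Permutation.Propositional.Properties
  using (shift; shifts; ++-assoc; ++-comm; ++⁺ˡ)
open import Data.Product using (_×_; _,_; proj₁; proj₂)
open import Relation.Binary.PropositionalEquality using (_≡_; refl; cong; subst; sym)

-- By induction on the first derivation, the type of a term is determined by
-- the set of declarations in scope, Γ ∪ Ω ∪ Δ: the rules only ever extend or
-- redistribute the scope, λ-abstractions carry their domain, and at a leaf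
-- the well-formedness side condition makes the scope a finite function from
-- variables to types, while ConstsUnique does the same for the signature.

module _ {a b} {A : Set a} {B : Set b} where

  Unique-map⇒injective-on : (f : A → B) {xs : List A} {x y : A} →
    Unique (map f xs) → x ∈ xs → y ∈ xs → f x ≡ f y → x ≡ y
  Unique-map⇒injective-on f (_ ∷ _) (here refl) (here refl) _ = refl
  Unique-map⇒injective-on f (_ ∷ uniq) (there x∈) (there y∈) fx≡fy =
    Unique-map⇒injective-on f uniq x∈ y∈ fx≡fy
  Unique-map⇒injective-on f {_ ∷ xs} uniq (here refl) (there y∈) fx≡fy =
    ⊥-elim (Unique[x∷xs]⇒x∉xs uniq (subst (_∈ map f xs) (sym fx≡fy) (∈-map⁺ f y∈)))
  Unique-map⇒injective-on f {_ ∷ xs} uniq (there x∈) (here refl) fx≡fy =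
    ⊥-elim (Unique[x∷xs]⇒x∉xs uniq (subst (_∈ map f xs) fx≡fy (∈-map⁺ f x∈)))

module _ {k v} {K : Set k} {V : Set v} where

  Unique-keys⇒functional : {kvs : List (K × V)} {x : K} {y y′ : V} →
    Unique (map proj₁ kvs) →
    (x , y) ∈ kvs → (x , y′) ∈ kvs → y ≡ y′
  Unique-keys⇒functional uniq x∈ x∈′ =
    cong proj₂ (Unique-map⇒injective-on proj₁ uniq x∈ x∈′ refl)

scope : Ctx → Ctx → Ctx → Ctx
scope Γ Ω Δ = Γ ++ Ω ++ Δ

scope-∷Ω : ∀ d Γ Ω Δ → scope Γ (d ∷ Ω) Δ ↭ d ∷ scope Γ Ω Δ
scope-∷Ω d Γ Ω Δ = shift d Γ (Ω ++ Δ)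

scope-∷Δ : ∀ d Γ Ω Δ → scope Γ Ω (d ∷ Δ) ↭ d ∷ scope Γ Ω Δ
scope-∷Δ d Γ Ω Δ = ↭-trans (++⁺ˡ Γ (shift d Ω Δ)) (shift d Γ (Ω ++ Δ))

scope-split : ∀ Γ Ω {Δ} ΔM ΔN → Δ ↭ ΔM ++ ΔN → scope (Γ ++ ΔN) Ω ΔM ↭ scope Γ Ω Δ
scope-split Γ Ω {Δ} ΔM ΔN Δ↭ = begin
  (Γ ++ ΔN) ++ Ω ++ ΔM  ↭⟨ ++-assoc Γ ΔN (Ω ++ ΔM) ⟩
  Γ ++ ΔN ++ Ω ++ ΔM    ↭⟨ ++⁺ˡ Γ (shifts ΔN Ω) ⟩
  Γ ++ Ω ++ ΔN ++ ΔM    ↭⟨ ++⁺ˡ Γ (++⁺ˡ Ω (↭-trans (++-comm ΔN ΔM) (↭-sym Δ↭))) ⟩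
  Γ ++ Ω ++ Δ           ∎
  where open PermutationReasoning

⊆-resp-↭ : ∀ {Φ Φ₀ Ψ Ψ₀ : Ctx} → Φ ↭ Φ₀ → Ψ ↭ Ψ₀ → Φ₀ ⊆ Ψ₀ → Φ ⊆ Ψ
⊆-resp-↭ Φ↭ Ψ↭ Φ₀⊆Ψ₀ = ⊆-respʳ-↭ (↭-sym Ψ↭) (⊆-respˡ-↭ (↭-sym Φ↭) Φ₀⊆Ψ₀)

⇒-injectiveʳ : ∀ {A A′ B B′ k k′} → A ⇒[ k ] B ≡ A′ ⇒[ k′ ] B′ → B ≡ B′
⇒-injectiveʳ refl = refl

module _ {Σ : Signature} where

  var-inversion : ∀ {Γ Ω Δ x A} → Σ ∣ Γ ⨾ Ω ⨾ Δ ⊢ var x ∶ A →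
    WF Γ Ω Δ × (x , A) ∈ scope Γ Ω Δ
  var-inversion (⊢varu wf x∈Γ)     = wf , ∈-++⁺ˡ x∈Γ
  var-inversion {Γ} {Ω} (⊢var1 wf) = wf , ∈-++⁺ʳ Γ (∈-++⁺ʳ Ω (here refl))

  var-unique : ∀ {Γ Ω Δ Γ′ Ω′ Δ′ x A A′} →
    Σ ∣ Γ ⨾ Ω ⨾ Δ ⊢ var x ∶ A → Σ ∣ Γ′ ⨾ Ω′ ⨾ Δ′ ⊢ var x ∶ A′ →
    scope Γ′ Ω′ Δ′ ⊆ scope Γ Ω Δ → A ≡ A′
  var-unique ⊢x ⊢x′ incl with var-inversion ⊢x | var-inversion ⊢x′
  ... | wf , x∈ | _ , x∈′ = Unique-keys⇒functional wf x∈ (incl x∈′)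

  ⊢-unique : ConstsUnique Σ → ∀ {Γ Ω Δ Γ′ Ω′ Δ′ M A A′} →
    Σ ∣ Γ ⨾ Ω ⨾ Δ ⊢ M ∶ A → Σ ∣ Γ′ ⨾ Ω′ ⨾ Δ′ ⊢ M ∶ A′ →
    scope Γ′ Ω′ Δ′ ⊆ scope Γ Ω Δ → A ≡ A′
  ⊢-unique cu (⊢con _ c∈) (⊢con _ c∈′) _ = Unique-keys⇒functional cu c∈ c∈′
  ⊢-unique cu ⊢x@(⊢varu _ _) ⊢x′ incl = var-unique ⊢x ⊢x′ incl
  ⊢-unique cu ⊢x@(⊢var1 _)   ⊢x′ incl = var-unique ⊢x ⊢x′ incl
  ⊢-unique cu (⊢lamu _ ⊢M) (⊢lamu _ ⊢M′) incl =
    cong (_ ⇒[ u ]_) (⊢-unique cu ⊢M ⊢M′ (∷⁺ʳ _ incl))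
  ⊢-unique cu {Γ} {Ω} {Δ} {Γ′} {Ω′} {Δ′} (⊢lam0 _ ⊢M) (⊢lam0 _ ⊢M′) incl =
    cong (_ ⇒[ zero ]_) (⊢-unique cu ⊢M ⊢M′
      (⊆-resp-↭ (scope-∷Ω _ Γ′ Ω′ Δ′) (scope-∷Ω _ Γ Ω Δ) (∷⁺ʳ _ incl)))
  ⊢-unique cu {Γ} {Ω} {Δ} {Γ′} {Ω′} {Δ′} (⊢lam1 _ ⊢M) (⊢lam1 _ ⊢M′) incl =
    cong (_ ⇒[ one ]_) (⊢-unique cu ⊢M ⊢M′
      (⊆-resp-↭ (scope-∷Δ _ Γ′ Ω′ Δ′) (scope-∷Δ _ Γ Ω Δ) (∷⁺ʳ _ incl)))
  ⊢-unique cu (⊢appu ⊢M _) (⊢appu ⊢M′ _) incl = ⇒-injectiveʳ (⊢-unique cu ⊢M ⊢M′ incl)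
  ⊢-unique cu (⊢app0 ⊢M _) (⊢app0 ⊢M′ _) incl = ⇒-injectiveʳ (⊢-unique cu ⊢M ⊢M′ incl)
  ⊢-unique cu {Γ} {Ω} {_} {Γ′} {Ω′}
      (⊢app1 {ΔM = ΔM} {ΔN} Δ↭ ⊢M _) (⊢app1 {ΔM = ΔM′} {ΔN′} Δ′↭ ⊢M′ _) incl =
    ⇒-injectiveʳ (⊢-unique cu ⊢M ⊢M′
      (⊆-resp-↭ (scope-split Γ′ Ω′ ΔM′ ΔN′ Δ′↭) (scope-split Γ Ω ΔM ΔN Δ↭) incl))

theorem3p1 : (Σ : Signature) → ConstsUnique Σ →
    ∀ {Γ Ω Δ Γ' Ω' Δ' M A A'} →
    (Γ ++ Ω ++ Δ) ≈ˢ (Γ' ++ Ω' ++ Δ') →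
    Σ ∣ Γ ⨾ Ω ⨾ Δ ⊢ M ∶ A →
    Σ ∣ Γ' ⨾ Ω' ⨾ Δ' ⊢ M ∶ A' →
    A ≡ A'
theorem3p1 Σ cu same-scope ⊢M ⊢M′ = ⊢-unique cu ⊢M ⊢M′ (λ {d} → proj₂ (same-scope d))
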